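{- Let $n=6k+r$ with integers $k\ge 1$ and $r\in\{0,1,\dots,5\}$. Then $$\gamma_{LTD}(M(P_n))\le\begin{cases}4k+2 & \text{if } r=0,\\ 4k+r+1 & \text{if } r\in\{1,2,3\},\\ 4k+r & \text{if } r\in\{4,5\}.\end{cases}$$ Moreover, for every $n\ge 3$, $$\gamma_{LTD}(M(C_n))\le\begin{cases} n-\left\lfloor\frac n3\right\rfloor+2 & \text{if } n \text{ is odd},\\ n-2\left\lfloor\frac n6\right\rfloor+2 & \text{if } n \text{ is even}.\end{cases}$$
   Context: All graphs are finite, simple and connected. For a graph $G=(V,E)$ and $x\in V$, $N(x)$ is the open neighbourhood. A set $C\subseteq V$ is a locating total-dominating set ($LTD$-set) if $N(x)\cap C\neq\emptyset$ for all $x\in V$ and $N(x)\cap C\neq N(y)\cap C$ for all distinct $x,y\in V\setminus C$; $\gamma_{LTD}(G)$ is the minimum size of an $LTD$-set. $P_n$ is the path and $C_n$ the cycle on $n$ vertices. The Mycielski graph $M(G)$ of $G$ with $V=\{v_1,\dots,v_n\}$ is obtained from $G$ by adding, for each $i$, a new vertex $u_i$ adjacent to every vertex of $N_G(v_i)$, and then adding one further vertex $u$ adjacent to all of $u_1,\dots,u_n$ (and to nothing else). -}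

module Defs where

open import Data.Nat using (ℕ; zero; suc; _+_; _*_; _≤_; _<_)
open import Data.Nat.DivMod using (_%_)
open import Data.Fin using (Fin; toℕ)
open import Data.Product using (_×_; ∃-syntax)
open import Data.Sum using (_⊎_)
open import Data.Unit using (⊤)
open import Data.Empty using (⊥)
open import Data.List using (List; length)
open import Data.List.Membership.Propositional using (_∈_; _∉_)
open import Data.List.Relation.Unary.Unique.Propositional using (Unique)
open import Relation.Binary.PropositionalEquality using (_≡_; _≢_)
open import Function.Bundles using (_⇔_)
open import Relation.Nullary using (¬_)

record Graph : Set₁ where
  field
    V   : Set
    Adj : V → V → Set
open Graph public

PAdj : (n : ℕ) → Fin n → Fin n → Set
PAdj n i j = (toℕ j ≡ suc (toℕ i)) ⊎ (toℕ i ≡ suc (toℕ j))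

P : ℕ → Graph
P n = record { V = Fin n ; Adj = PAdj n }

CAdj : (n : ℕ) → Fin n → Fin n → Set
CAdj (suc n) i j = (toℕ j ≡ suc (toℕ i) % suc n) ⊎ (toℕ i ≡ suc (toℕ j) % suc n)
CAdj zero () _

C : ℕ → Graph
C n = record { V = Fin n ; Adj = CAdj n }

-- Vertices of the Mycielski graph: v x (original), u x (shadow), w (the extra vertex u).
data MV (A : Set) : Set where
  v : A → MV A
  u : A → MV A
  w : MV A

MAdj : (G : Graph) → MV (V G) → MV (V G) → Set
MAdj G (v x) (v y) = Adj G x y
MAdj G (v x) (u y) = Adj G x y
MAdj G (u x) (v y) = Adj G x y
MAdj G (u x) (u y) = ⊥
MAdj G (u x) w     = ⊤
MAdj G w     (u y) = ⊤
MAdj G (v x) w     = ⊥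
MAdj G w     (v y) = ⊥
MAdj G w     w     = ⊥

M : Graph → Graph
M G = record { V = MV (V G) ; Adj = MAdj G }

record IsLTD (G : Graph) (S : List (V G)) : Set where
  field
    total    : ∀ x → ∃[ y ] (y ∈ S × Adj G x y)
    locating : ∀ x y → x ∉ S → y ∉ S → x ≢ y →
               ¬ (∀ z → (z ∈ S × Adj G x z) ⇔ (z ∈ S × Adj G y z))

γLTD≤ : Graph → ℕ → Set
γLTD≤ G b = ∃[ S ] (Unique S × IsLTD G S × length S ≤ b)

pathBound : ℕ → ℕ → ℕ
pathBound k 0 = 4 * k + 2
pathBound k 1 = 4 * k + 1 + 1
pathBound k 2 = 4 * k + 2 + 1
pathBound k 3 = 4 * k + 3 + 1
pathBound k 4 = 4 * k + 4
pathBound k 5 = 4 * k + 5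
pathBound k (suc (suc (suc (suc (suc (suc r)))))) = 0  -- unreachable (r ≤ 5)

-- For a graph G and sets T, U of its vertices put S = {v k ∣ k ∈ T} ∪ {u k ∣ k ∈ U} ∪ {w}.
-- Every shadow vertex u k is dominated by w, and w separates each v k from each u l; so S
-- is a locating total-dominating set of M(G) as soon as T ∪ U dominates G and locates the
-- vertices outside T, while T alone locates the vertices outside U.
-- For P_n and C_n on 0, …, n − 1 take T = {k ∣ k mod 3 ≠ 2} (dropping the last vertex of
-- the path) and a single hub J (J = 1 on the cycle, J the last vertex ≡ 2 mod 3 on the
-- path). A vertex k ≢ 0 mod 3 is seen by its predecessor, which lies in T and sees no later
-- vertex; the other cases are settled by a successor. On C_4
-- opposite vertices have equal neighbourhoods, so a single hub cannot work and two are used.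
module Submission where

open import Defs
open import Data.Nat using (ℕ; zero; suc; _+_; _*_; _∸_; _≤_; _<_; z≤n; s≤s; z<s; s<s; _≟_; _<?_)
open import Data.Nat.Properties
open import Data.Nat.DivMod using (_/_; _%_; m≡m%n+[m/n]*n; m%n<n; m<n⇒m%n≡m; n%n≡0; m/n/o≡m/[n*o]; m/n*n≤m)
open import Data.Nat.Tactic.RingSolver using (solve; solve-∀)
open import Data.Fin using (Fin; toℕ; fromℕ<)
open import Data.Fin.Properties using (toℕ<n; toℕ-fromℕ<; toℕ-injective)
open import Data.Product using (_×_; _,_; ∃-syntax; proj₁; proj₂)
import Data.Product as Product
open import Data.Sum using (_⊎_; inj₁; inj₂)
import Data.Sum as Sum
open import Data.Unit using (tt)
open import Data.Empty using (⊥-elim)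
open import Data.List using (List; []; _∷_; _++_; [_]; map; filter; length; upTo; allFin; tabulate; applyUpTo)
open import Data.List.Properties using (length-map; length-++; filter-++; filter-accept; filter-reject; map-tabulate; upTo-∷ʳ)
open import Data.List.Membership.Propositional using (_∈_; _∉_)
open import Data.List.Membership.Propositional.Properties using (∈-map⁺; ∈-map⁻; ∈-++⁺ˡ; ∈-++⁺ʳ; ∈-filter⁺; ∈-allFin)
open import Data.List.Relation.Unary.Any using (here; there)
open import Data.List.Relation.Unary.All using ([])
open import Data.List.Relation.Unary.All.Properties using (¬Any⇒All¬)
open import Data.List.Relation.Unary.AllPairs using ([]; _∷_)
open import Data.List.Relation.Unary.Unique.Propositional using (Unique)
import Data.List.Relation.Unary.Unique.Propositional.Properties as Unique
open import Function using (_∘_; id; case_of_; _∋_)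
open import Function.Bundles using (_⇔_; Equivalence; mk⇔)
open import Relation.Binary.Definitions using (tri<; tri≈; tri>)
open import Relation.Binary.PropositionalEquality using (_≡_; _≢_; refl; sym; trans; cong; cong₂; subst; module ≡-Reasoning)
open import Relation.Nullary using (¬_; Dec; yes; no; ¬?)
open import Relation.Nullary.Decidable using (_×-dec_)
open import Relation.Unary using (Decidable)

open Equivalence using (to; from)

Separates : {A : Set} → (A → A → Set) → A → A → A → Set
Separates R x y z = (R x z × ¬ R y z) ⊎ (R y z × ¬ R x z)

γLTD≤-mono : ∀ {G a b} → a ≤ b → γLTD≤ G a → γLTD≤ G b
γLTD≤-mono a≤b = Product.map₂ (Product.map₂ (Product.map₂ (λ ∣S∣≤a → ≤-trans ∣S∣≤a a≤b)))

record MycielskiCertificate (G : Graph) (T U : V G → Set) : Set where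
  field
    dominating : ∀ x → ∃[ z ] ((T z ⊎ U z) × Adj G x z)
    hub        : ∃[ z ] U z
    locatingᵛ  : ∀ {x y} → x ≢ y → ¬ T x → ¬ T y →
                 ∃[ z ] ((T z ⊎ U z) × Separates (Adj G) x y z)
    locatingᵘ  : ∀ {x y} → x ≢ y → ¬ U x → ¬ U y → ∃[ z ] (T z × Separates (Adj G) x y z)

mycielskiSet : {A : Set} → List A → List A → List (MV A)
mycielskiSet Ts Us = map v Ts ++ w ∷ map u Us

module _ {A : Set} {Ts Us : List A} where

  v∈mycielskiSet : ∀ {x} → x ∈ Ts → v x ∈ mycielskiSet Ts Us
  v∈mycielskiSet x∈Ts = ∈-++⁺ˡ (∈-map⁺ v x∈Ts)

  u∈mycielskiSet : ∀ {x} → x ∈ Us → u x ∈ mycielskiSet Ts Us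
  u∈mycielskiSet x∈Us = ∈-++⁺ʳ (map v Ts) (there (∈-map⁺ u x∈Us))

  w∈mycielskiSet : w ∈ mycielskiSet Ts Us
  w∈mycielskiSet = ∈-++⁺ʳ (map v Ts) (here refl)

  length-mycielskiSet : length (mycielskiSet Ts Us) ≡ length Ts + suc (length Us)
  length-mycielskiSet = trans (length-++ (map v Ts))
                              (cong₂ _+_ (length-map v Ts) (cong suc (length-map u Us)))

  mycielskiSet-unique : Unique Ts → Unique Us → Unique (mycielskiSet Ts Us)
  mycielskiSet-unique Ts-unique Us-unique =
    Unique.++⁺ (Unique.map⁺ v-injective Ts-unique)
               (¬Any⇒All¬ (map u Us) w∉u[Us] ∷ Unique.map⁺ u-injective Us-unique)
               v[Ts]-disjoint
    where
    v-injective : ∀ {x y} → v x ≡ v y → x ≡ y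
    v-injective refl = refl

    u-injective : ∀ {x y} → u x ≡ u y → x ≡ y
    u-injective refl = refl

    w∉u[Us] : w ∉ map u Us
    w∉u[Us] w∈ with ∈-map⁻ u w∈
    ... | _ , _ , ()

    v[Ts]-disjoint : ∀ {z} → ¬ (z ∈ map v Ts × z ∈ w ∷ map u Us)
    v[Ts]-disjoint (z∈v , _) with ∈-map⁻ v z∈v
    v[Ts]-disjoint (_ , here ()) | _ , _ , refl
    v[Ts]-disjoint (_ , there z∈u) | _ , _ , refl with ∈-map⁻ u z∈u
    ... | _ , _ , ()

mycielski-γLTD≤ : ∀ {G T U} (Ts Us : List (V G)) → Unique Ts → Unique Us →
                  (∀ {x} → T x → x ∈ Ts) → (∀ {x} → U x → x ∈ Us) →
                  MycielskiCertificate G T U → γLTD≤ (M G) (length Ts + suc (length Us))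
mycielski-γLTD≤ {G} {T} {U} Ts Us Ts-unique Us-unique T⊆Ts U⊆Us cert =
  S , mycielskiSet-unique Ts-unique Us-unique , record { total = total ; locating = locating } ,
  ≤-reflexive (length-mycielskiSet {Ts = Ts} {Us})
  where
  open MycielskiCertificate cert

  S : List (MV (V G))
  S = mycielskiSet Ts Us

  v∈S : ∀ {x} → T x → v x ∈ S
  v∈S = v∈mycielskiSet ∘ T⊆Ts

  u∈S : ∀ {x} → U x → u x ∈ S
  u∈S = u∈mycielskiSet ∘ U⊆Us

  w∈S : w ∈ S
  w∈S = w∈mycielskiSet

  total : ∀ x → ∃[ z ] (z ∈ S × MAdj G x z)
  total (v x) with dominating x
  ... | z , inj₁ t , x~z = v z , v∈S t , x~z
  ... | z , inj₂ h , x~z = u z , u∈S h , x~z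
  total (u x) = w , w∈S , tt
  total w with hub
  ... | z , h = u z , u∈S h , tt

  separated : ∀ x y z → z ∈ S → Separates (MAdj G) x y z →
              ¬ (∀ z → (z ∈ S × MAdj G x z) ⇔ (z ∈ S × MAdj G y z))
  separated _ _ z z∈S (inj₁ (x~z , y≁z)) same = y≁z (proj₂ (to (same z) (z∈S , x~z)))
  separated _ _ z z∈S (inj₂ (y~z , x≁z)) same = x≁z (proj₂ (from (same z) (z∈S , y~z)))

  locating : ∀ x y → x ∉ S → y ∉ S → x ≢ y →
             ¬ (∀ z → (z ∈ S × MAdj G x z) ⇔ (z ∈ S × MAdj G y z))
  locating (v x) (v y) x∉S y∉S x≢y with locatingᵛ (x≢y ∘ cong v) (x∉S ∘ v∈S) (y∉S ∘ v∈S)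
  ... | z , inj₁ t , s = separated (v x) (v y) (v z) (v∈S t) s
  ... | z , inj₂ h , s = separated (v x) (v y) (u z) (u∈S h) s
  locating (u x) (u y) x∉S y∉S x≢y with locatingᵘ (x≢y ∘ cong u) (x∉S ∘ u∈S) (y∉S ∘ u∈S)
  ... | z , t , s = separated (u x) (u y) (v z) (v∈S t) s
  locating (v x) (u y) _ _ _ = separated (v x) (u y) w w∈S (inj₂ (tt , λ ()))
  locating (u x) (v y) _ _ _ = separated (u x) (v y) w w∈S (inj₁ (tt , λ ()))
  locating w _ w∉S _ _ = ⊥-elim (w∉S w∈S)
  locating _ w _ w∉S _ = ⊥-elim (w∉S w∈S)

finGraph : (n : ℕ) → (Fin n → Fin n → Set) → Graph
finGraph n A = record { V = Fin n ; Adj = A }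

record SegmentCertificate (n : ℕ) (R : ℕ → ℕ → Set) (T U : ℕ → Set) : Set where
  field
    dominating : ∀ {a} → a < n → ∃[ k ] (k < n × (T k ⊎ U k) × R a k)
    hub        : ∃[ k ] (k < n × U k)
    locatingᵛ  : ∀ {a b} → a < b → b < n → ¬ T a → ¬ T b →
                 ∃[ k ] (k < n × (T k ⊎ U k) × Separates R a b k)
    locatingᵘ  : ∀ {a b} → a < b → b < n → ¬ U a → ¬ U b →
                 ∃[ k ] (k < n × T k × Separates R a b k)

segment⇒mycielski : ∀ {n A R T U} → (∀ i j → A i j ⇔ R (toℕ i) (toℕ j)) →
                    SegmentCertificate n R T U →
                    MycielskiCertificate (finGraph n A) (T ∘ toℕ) (U ∘ toℕ)
segment⇒mycielski {n} {A} {R} {T} {U} A⇔R cert = record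
  { dominating = dominating′
  ; hub        = vertex hub
  ; locatingᵛ  = ordered locatingᵛ
  ; locatingᵘ  = ordered locatingᵘ
  }
  where
  open SegmentCertificate cert

  vertex : ∀ {Q : ℕ → Set} → ∃[ k ] (k < n × Q k) → ∃[ z ] Q (toℕ z)
  vertex {Q} (k , k<n , q) = fromℕ< k<n , subst Q (sym (toℕ-fromℕ< k<n)) q

  dominating′ : ∀ x → ∃[ z ] ((T (toℕ z) ⊎ U (toℕ z)) × A x z)
  dominating′ x with vertex (dominating (toℕ<n x))
  ... | z , tu , x~z = z , tu , from (A⇔R x z) x~z

  separates : ∀ {x y z} → Separates R (toℕ x) (toℕ y) (toℕ z) → Separates A x y z
  separates {x} {y} {z} = Sum.map (Product.map (from (A⇔R x z)) (_∘ to (A⇔R y z)))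
                                  (Product.map (from (A⇔R y z)) (_∘ to (A⇔R x z)))

  located : ∀ {W : ℕ → Set} {x y} → ∃[ k ] (k < n × W k × Separates R (toℕ x) (toℕ y) k) →
            ∃[ z ] (W (toℕ z) × Separates A x y z)
  located {W} {x} {y} loc with vertex {λ k → W k × Separates R (toℕ x) (toℕ y) k} loc
  ... | z , wz , s = z , wz , separates s

  ordered : ∀ {P W : ℕ → Set} →
            (∀ {a b} → a < b → b < n → P a → P b → ∃[ k ] (k < n × W k × Separates R a b k)) →
            ∀ {x y} → x ≢ y → P (toℕ x) → P (toℕ y) → ∃[ z ] (W (toℕ z) × Separates A x y z)
  ordered sep {x} {y} x≢y px py with <-cmp (toℕ x) (toℕ y)
  ... | tri< x<y _ _ = located (sep x<y (toℕ<n y) px py)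
  ... | tri≈ _ x≡y _ = ⊥-elim (x≢y (toℕ-injective x≡y))
  ... | tri> _ _ y<x = located (Product.map₂ (Product.map₂ (Product.map₂ Sum.swap)) (sep y<x (toℕ<n x) py px))

count : {P : ℕ → Set} → Decidable P → ℕ → ℕ
count P? n = length (filter P? (upTo n))

count-suc : ∀ {P : ℕ → Set} (P? : Decidable P) n →
            count P? (suc n) ≡ count P? n + length (filter P? [ n ])
count-suc P? n = begin
  length (filter P? (upTo (suc n)))                ≡⟨ cong (length ∘ filter P?) (sym (upTo-∷ʳ n)) ⟩
  length (filter P? (upTo n ++ [ n ]))             ≡⟨ cong length (filter-++ P? (upTo n) [ n ]) ⟩
  length (filter P? (upTo n) ++ filter P? [ n ])   ≡⟨ length-++ (filter P? (upTo n)) ⟩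
  count P? n + length (filter P? [ n ])            ∎
  where open ≡-Reasoning

count-accept : ∀ {P : ℕ → Set} (P? : Decidable P) {n} → P n → count P? (suc n) ≡ suc (count P? n)
count-accept P? {n} p = trans (count-suc P? n)
  (trans (cong (λ xs → count P? n + length xs) (filter-accept P? p)) (+-comm _ 1))

count-reject : ∀ {P : ℕ → Set} (P? : Decidable P) {n} → ¬ P n → count P? (suc n) ≡ count P? n
count-reject P? {n} ¬p = trans (count-suc P? n)
  (trans (cong (λ xs → count P? n + length xs) (filter-reject P? ¬p)) (+-identityʳ _))

count-cong : ∀ {P Q : ℕ → Set} (P? : Decidable P) (Q? : Decidable Q) n →
             (∀ {k} → k < n → P k ⇔ Q k) → count P? n ≡ count Q? n
count-cong P? Q? zero    _   = refl
count-cong P? Q? (suc n) P⇔Q with P? n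
... | yes p = trans (count-accept P? p)
                (trans (cong suc (count-cong P? Q? n (P⇔Q ∘ m<n⇒m<1+n)))
                       (sym (count-accept Q? (to (P⇔Q (n<1+n n)) p))))
... | no ¬p = trans (count-reject P? ¬p)
                (trans (count-cong P? Q? n (P⇔Q ∘ m<n⇒m<1+n))
                       (sym (count-reject Q? (¬p ∘ from (P⇔Q (n<1+n n))))))

count-periodic : ∀ {P : ℕ → Set} (P? : Decidable P) p → (∀ {x} → P (p + x) ⇔ P x) →
                 ∀ x → count P? (p + x) ≡ count P? p + count P? x
count-periodic P? p periodic zero =
  trans (cong (count P?) (+-identityʳ p)) (sym (+-identityʳ _))
count-periodic P? p periodic (suc x) with P? x
... | yes px = begin
  count P? (p + suc x)            ≡⟨ cong (count P?) (+-suc p x) ⟩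
  count P? (suc (p + x))          ≡⟨ count-accept P? (from periodic px) ⟩
  suc (count P? (p + x))          ≡⟨ cong suc (count-periodic P? p periodic x) ⟩
  suc (count P? p + count P? x)   ≡⟨ sym (+-suc _ _) ⟩
  count P? p + suc (count P? x)   ≡⟨ cong (count P? p +_) (sym (count-accept P? px)) ⟩
  count P? p + count P? (suc x)   ∎
  where open ≡-Reasoning
... | no ¬px = begin
  count P? (p + suc x)            ≡⟨ cong (count P?) (+-suc p x) ⟩
  count P? (suc (p + x))          ≡⟨ count-reject P? (¬px ∘ to periodic) ⟩
  count P? (p + x)                ≡⟨ count-periodic P? p periodic x ⟩
  count P? p + count P? x         ≡⟨ cong (count P? p +_) (sym (count-reject P? ¬px)) ⟩
  count P? p + count P? (suc x)   ∎
  where open ≡-Reasoning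

select : {P : ℕ → Set} → Decidable P → (n : ℕ) → List (Fin n)
select P? n = filter (P? ∘ toℕ) (allFin n)

∈-select : ∀ {P : ℕ → Set} (P? : Decidable P) {n} {x : Fin n} → P (toℕ x) → x ∈ select P? n
∈-select P? {x = x} = ∈-filter⁺ (P? ∘ toℕ) (∈-allFin x)

select-unique : ∀ {P : ℕ → Set} (P? : Decidable P) n → Unique (select P? n)
select-unique P? n = Unique.filter⁺ (P? ∘ toℕ) (Unique.allFin⁺ n)

filter-map : ∀ {A B : Set} {P : B → Set} (P? : Decidable P) (f : A → B) xs →
             filter P? (map f xs) ≡ map f (filter (P? ∘ f) xs)
filter-map P? f [] = refl
filter-map {P = P} P? f (x ∷ xs) = by-cases (P? (f x))
  where
  by-cases : Dec (P (f x)) → filter P? (f x ∷ map f xs) ≡ map f (filter (P? ∘ f) (x ∷ xs))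
  by-cases (yes p) = trans (filter-accept P? p)
    (trans (cong (f x ∷_) (filter-map P? f xs)) (sym (cong (map f) (filter-accept (P? ∘ f) p))))
  by-cases (no ¬p) = trans (filter-reject P? ¬p)
    (trans (filter-map P? f xs) (sym (cong (map f) (filter-reject (P? ∘ f) ¬p))))

tabulate-toℕ : ∀ {A : Set} (f : ℕ → A) n → tabulate {n = n} (f ∘ toℕ) ≡ applyUpTo f n
tabulate-toℕ f zero    = refl
tabulate-toℕ f (suc n) = cong (f 0 ∷_) (tabulate-toℕ (f ∘ suc) n)

length-select : ∀ {P : ℕ → Set} (P? : Decidable P) n → length (select P? n) ≡ count P? n
length-select P? n = begin
  length (filter (P? ∘ toℕ) (allFin n))           ≡⟨ sym (length-map toℕ (filter (P? ∘ toℕ) (allFin n))) ⟩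
  length (map toℕ (filter (P? ∘ toℕ) (allFin n))) ≡⟨ cong length (sym (filter-map P? toℕ (allFin n))) ⟩
  length (filter P? (map toℕ (allFin n)))          ≡⟨ cong (length ∘ filter P?) map-toℕ-allFin ⟩
  count P? n                                       ∎
  where
  open ≡-Reasoning
  map-toℕ-allFin : map toℕ (allFin n) ≡ upTo n
  map-toℕ-allFin = trans (map-tabulate id toℕ) (tabulate-toℕ id n)

segment-γLTD≤ : ∀ {n A R T J} (T? : Decidable T) → J < n → (∀ i j → A i j ⇔ R (toℕ i) (toℕ j)) →
                SegmentCertificate n R T (_≡ J) → γLTD≤ (M (finGraph n A)) (count T? n + 2)
segment-γLTD≤ {n} {J = J} T? J<n A⇔R cert =
  subst (λ c → γLTD≤ _ (c + 2)) (length-select T? n)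
    (mycielski-γLTD≤ (select T? n) [ fromℕ< J<n ] (select-unique T? n) ([] ∷ [])
                     (∈-select T?) (λ x≡J → here (toℕ-injective (trans x≡J (sym (toℕ-fromℕ< J<n)))))
                     (segment⇒mycielski A⇔R cert))

mod3 : ℕ → ℕ
mod3 0                   = 0
mod3 1                   = 1
mod3 2                   = 2
mod3 (suc (suc (suc n))) = mod3 n

next3 : ℕ → ℕ
next3 0 = 1
next3 1 = 2
next3 _ = 0

mod3-suc : ∀ x → mod3 (suc x) ≡ next3 (mod3 x)
mod3-suc 0                   = refl
mod3-suc 1                   = refl
mod3-suc 2                   = refl
mod3-suc (suc (suc (suc x))) = mod3-suc x

mod3-shift : ∀ x {r} → mod3 x ≡ r → mod3 (suc x) ≡ next3 r
mod3-shift x x≡r = trans (mod3-suc x) (cong next3 x≡r)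

mod3-window : ∀ {x y} → mod3 x ≡ mod3 y → x ≤ 2 + y → y ≤ 2 + x → x ≡ y
mod3-window {suc (suc (suc x))} {suc (suc (suc y))} e (s≤s (s≤s (s≤s x≤))) (s≤s (s≤s (s≤s y≤))) =
  cong (3 +_) (mod3-window e x≤ y≤)
mod3-window {0} {0} _ _ _ = refl
mod3-window {1} {1} _ _ _ = refl
mod3-window {2} {2} _ _ _ = refl
mod3-window {0} {1} ()
mod3-window {0} {2} ()
mod3-window {1} {0} ()
mod3-window {1} {2} ()
mod3-window {1} {3} ()
mod3-window {2} {0} ()
mod3-window {2} {1} ()
mod3-window {2} {3} ()
mod3-window {2} {4} ()
mod3-window {3} {1} ()
mod3-window {3} {2} ()
mod3-window {4} {2} ()
mod3-window {0} {suc (suc (suc _))} _ _ (s≤s (s≤s ()))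
mod3-window {1} {suc (suc (suc (suc _)))} _ _ (s≤s (s≤s (s≤s ())))
mod3-window {2} {suc (suc (suc (suc (suc _))))} _ _ (s≤s (s≤s (s≤s (s≤s ()))))
mod3-window {suc (suc (suc _))} {0} _ (s≤s (s≤s ())) _
mod3-window {suc (suc (suc (suc _)))} {1} _ (s≤s (s≤s (s≤s ()))) _
mod3-window {suc (suc (suc (suc (suc _))))} {2} _ (s≤s (s≤s (s≤s (s≤s ())))) _

Kept : ℕ → Set
Kept k = mod3 k ≢ 2

kept? : Decidable Kept
kept? k = ¬? (mod3 k ≟ 2)

kept-of : ∀ x {r} → mod3 x ≡ r → r ≢ 2 → Kept x
kept-of _ x≡r r≢2 x≡2 = r≢2 (trans (sym x≡r) x≡2)

kept-suc : ∀ x → mod3 x ≡ 0 → Kept (suc x)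
kept-suc x x≡0 = kept-of (suc x) (mod3-shift x x≡0) (λ ())

¬kept⇒≢0 : ∀ x → ¬ Kept x → mod3 x ≢ 0
¬kept⇒≢0 x ¬kept x≡0 = ¬kept (kept-of x x≡0 (λ ()))

predecessor : ∀ {a} → mod3 a ≢ 0 → ∃[ a′ ] (a ≡ suc a′ × Kept a′)
predecessor {zero}   a≢0 = ⊥-elim (a≢0 refl)
predecessor {suc a′} a≢0 = a′ , refl , a≢0 ∘ mod3-shift a′

last-residue-2 : ∀ m → 2 ≤ m → ∃[ J ] (mod3 J ≡ 2 × J ≤ m × m ≤ 2 + J)
last-residue-2 0 ()
last-residue-2 1 (s≤s ())
last-residue-2 2 _ = 2 , refl , ≤-refl , m≤n+m 2 2
last-residue-2 3 _ = 2 , refl , n≤1+n 2 , n≤1+n 3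
last-residue-2 4 _ = 2 , refl , m≤n+m 2 2 , ≤-refl
last-residue-2 (suc (suc (suc (suc (suc m))))) _
  with last-residue-2 (suc (suc m)) (s≤s (s≤s z≤n))
... | J , J≡2 , J≤m , m≤2+J = 3 + J , J≡2 , s≤s (s≤s (s≤s J≤m)) , s≤s (s≤s (s≤s m≤2+J))

count-kept : ∀ q s → count kept? (3 * q + s) ≡ 2 * q + count kept? s
count-kept zero    s = refl
count-kept (suc q) s = begin
  count kept? (3 * suc q + s)     ≡⟨ cong (λ t → count kept? (t + s)) (*-suc 3 q) ⟩
  count kept? (3 + 3 * q + s)     ≡⟨ cong (count kept?) (+-assoc 3 (3 * q) s) ⟩
  count kept? (3 + (3 * q + s))   ≡⟨ count-periodic kept? 3 (mk⇔ id id) (3 * q + s) ⟩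
  2 + count kept? (3 * q + s)     ≡⟨ cong (2 +_) (count-kept q s) ⟩
  2 + (2 * q + count kept? s)     ≡⟨ sym (+-assoc 2 (2 * q) _) ⟩
  2 + 2 * q + count kept? s       ≡⟨ cong (_+ count kept? s) (sym (*-suc 2 q)) ⟩
  2 * suc q + count kept? s       ∎
  where open ≡-Reasoning

count-kept-∸ : ∀ n → count kept? n ≡ n ∸ n / 3
count-kept-∸ n = begin
  count kept? n               ≡⟨ cong (count kept?) n≡3q+s ⟩
  count kept? (3 * q + s)     ≡⟨ count-kept q s ⟩
  2 * q + count kept? s       ≡⟨ cong (2 * q +_) (count-kept-small (m%n<n n 3)) ⟩
  2 * q + s                   ≡⟨ sym (m+n∸n≡m (2 * q + s) q) ⟩
  2 * q + s + q ∸ q           ≡⟨ cong (_∸ q) (rearrange q s) ⟩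
  3 * q + s ∸ q               ≡⟨ cong (_∸ q) (sym n≡3q+s) ⟩
  n ∸ q                       ∎
  where
  open ≡-Reasoning
  q s : ℕ
  q = n / 3
  s = n % 3
  n≡3q+s : n ≡ 3 * q + s
  n≡3q+s = trans (m≡m%n+[m/n]*n n 3) (trans (+-comm s (q * 3)) (cong (_+ s) (*-comm q 3)))
  rearrange : ∀ x y → 2 * x + y + x ≡ 3 * x + y
  rearrange = solve-∀
  count-kept-small : ∀ {r} → r < 3 → count kept? r ≡ r
  count-kept-small {0} _ = refl
  count-kept-small {1} _ = refl
  count-kept-small {2} _ = refl
  count-kept-small {suc (suc (suc _))} (s≤s (s≤s (s≤s ())))

m<n⇒n≡1+m∨n≡2+m∨2+m<n : ∀ {m n} → m < n → n ≡ suc m ⊎ n ≡ 2 + m ⊎ 2 + m < n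
m<n⇒n≡1+m∨n≡2+m∨2+m<n m<n with m≤n⇒m<n∨m≡n m<n
... | inj₂ refl = inj₁ refl
... | inj₁ 1+m<n with m≤n⇒m<n∨m≡n 1+m<n
...   | inj₂ refl = inj₂ (inj₁ refl)
...   | inj₁ 2+m<n = inj₂ (inj₂ 2+m<n)

-- Paths.

Consecutive : ℕ → ℕ → Set
Consecutive a b = b ≡ suc a ⊎ a ≡ suc b

consecutive-irrefl : ∀ {x} → ¬ Consecutive x x
consecutive-irrefl (inj₁ x≡1+x) = 1+n≢n (sym x≡1+x)
consecutive-irrefl (inj₂ x≡1+x) = 1+n≢n (sym x≡1+x)

¬consecutive-gap : ∀ {x y} → 2 + x ≤ y → ¬ Consecutive y x
¬consecutive-gap 2+x≤y (inj₁ x≡1+y) = <-asym (<-trans (n<1+n _) 2+x≤y) (subst (_ <_) (sym x≡1+y) (n<1+n _))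
¬consecutive-gap 2+x≤y (inj₂ y≡1+x) = <-irrefl (sym y≡1+x) 2+x≤y

PathKept : ℕ → ℕ → Set
PathKept m k = k < m × Kept k

pathKept? : ∀ m → Decidable (PathKept m)
pathKept? m k = (k <? m) ×-dec kept? k

path-certificate : ∀ {m J} → mod3 J ≡ 2 → J ≤ m → m ≤ 2 + J →
                   SegmentCertificate (suc m) Consecutive (PathKept m) (_≡ J)
path-certificate {m} {J} J≡2 J≤m m≤2+J = record
  { dominating = dominating
  ; hub        = J , s≤s J≤m , refl
  ; locatingᵛ  = locatingᵛ
  ; locatingᵘ  = locatingᵘ
  }
  where
  Witness : (ℕ → Set) → ℕ → ℕ → Set
  Witness W a b = ∃[ k ] (k < suc m × W k × Separates Consecutive a b k)

  separating-predecessor : ∀ {a b} → a < b → b ≤ m → mod3 a ≢ 0 → Witness (PathKept m) a b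
  separating-predecessor {a} a<b b≤m a≢0 with predecessor {a} a≢0
  ... | a′ , refl , kept = a′ , m<n⇒m<1+n a′<m , (a′<m , kept) , inj₁ (inj₂ refl , ¬consecutive-gap a<b)
    where
    a′<m : a′ < m
    a′<m = <-≤-trans (<-trans (n<1+n a′) a<b) b≤m

  dominating : ∀ {a} → a < suc m → ∃[ k ] (k < suc m × (PathKept m k ⊎ k ≡ J) × Consecutive a k)
  dominating {a} a<n with mod3 a ≟ 0
  ... | no a≢0 with predecessor {a} a≢0
  ...   | a′ , refl , kept = a′ , <-trans (n<1+n a′) a<n , inj₁ (≤-pred a<n , kept) , inj₂ refl
  dominating {a} a<n | yes a≡0 with suc a <? m
  ...   | yes 1+a<m = suc a , m<n⇒m<1+n 1+a<m , inj₁ (1+a<m , kept-suc a a≡0) , inj₁ refl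
  ...   | no 1+a≮m = J , s≤s J≤m , inj₂ refl , inj₂ (mod3-window residues a≤3+J 1+J≤2+a)
    where
    residues : mod3 a ≡ mod3 (suc J)
    residues = trans a≡0 (sym (mod3-shift J J≡2))
    a≤3+J : a ≤ 2 + suc J
    a≤3+J = ≤-trans (≤-pred a<n) (≤-trans m≤2+J (n≤1+n (2 + J)))
    1+J≤2+a : suc J ≤ 2 + a
    1+J≤2+a = s≤s (≤-trans J≤m (≮⇒≥ 1+a≮m))

  locatingᵛ : ∀ {a b} → a < b → b < suc m → ¬ PathKept m a → ¬ PathKept m b →
              Witness (λ k → PathKept m k ⊎ k ≡ J) a b
  locatingᵛ {a} a<b b<n ¬Ta _
    with separating-predecessor a<b (≤-pred b<n) (¬kept⇒≢0 a (¬Ta ∘ (<-≤-trans a<b (≤-pred b<n) ,_)))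
  ... | k , k<n , t , s = k , k<n , inj₁ t , s

  locatingᵘ : ∀ {a b} → a < b → b < suc m → a ≢ J → b ≢ J → Witness (PathKept m) a b
  locatingᵘ {a} a<b b<n _ b≢J with mod3 a ≟ 0
  ... | no a≢0 = separating-predecessor a<b (≤-pred b<n) a≢0
  ... | yes a≡0 with m<n⇒n≡1+m∨n≡2+m∨2+m<n a<b
  ...   | inj₁ refl =
          a , <-trans a<b b<n , (≤-pred b<n , kept-of a a≡0 (λ ())) , inj₂ (inj₂ refl , consecutive-irrefl)
  ...   | inj₂ (inj₂ 2+a<b) =
          suc a , <-trans (<-trans (n<1+n _) 2+a<b) b<n ,
          (<-≤-trans (<-trans (n<1+n _) 2+a<b) (≤-pred b<n) , kept-suc a a≡0) ,
          inj₁ (inj₁ refl , ¬consecutive-gap 2+a<b)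
  ...   | inj₂ (inj₁ refl) with 3 + a <? m
  ...     | yes 3+a<m = 3 + a , m<n⇒m<1+n 3+a<m , (3+a<m , kept-of a a≡0 (λ ())) ,
                        inj₂ (inj₁ refl , ¬consecutive-gap (s≤s (s≤s (n≤1+n a))) ∘ Sum.swap)
  ...     | no 3+a≮m = ⊥-elim (b≢J (mod3-window residues b≤2+J J≤2+b))
    where
    residues : mod3 (2 + a) ≡ mod3 J
    residues = trans (mod3-shift (suc a) (mod3-shift a a≡0)) (sym J≡2)
    b≤2+J : 2 + a ≤ 2 + J
    b≤2+J = ≤-trans (≤-pred b<n) m≤2+J
    J≤2+b : J ≤ 2 + (2 + a)
    J≤2+b = ≤-trans J≤m (≤-trans (≮⇒≥ 3+a≮m) (n≤1+n (3 + a)))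

path-γLTD≤ : ∀ m → 2 ≤ m → γLTD≤ (M (P (suc m))) (count kept? m + 2)
path-γLTD≤ m 2≤m with last-residue-2 m 2≤m
... | J , J≡2 , J≤m , m≤2+J =
  subst (λ c → γLTD≤ (M (P (suc m))) (c + 2)) count-pathKept
    (segment-γLTD≤ (pathKept? m) (s≤s J≤m) (λ _ _ → mk⇔ id id) (path-certificate J≡2 J≤m m≤2+J))
  where
  count-pathKept : count (pathKept? m) (suc m) ≡ count kept? m
  count-pathKept = trans (count-reject (pathKept? m) (<-irrefl refl ∘ proj₁))
                         (count-cong (pathKept? m) kept? m (λ k<m → mk⇔ proj₂ (k<m ,_)))

-- Cycles.

Follows : ℕ → ℕ → ℕ → Set
Follows n a b = b ≡ suc a ⊎ (b ≡ 0 × suc a ≡ n)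

CycleAdj : ℕ → ℕ → ℕ → Set
CycleAdj n a b = Follows n a b ⊎ Follows n b a

≡suc%⇔follows : ∀ {n a b} → a < suc n → b < suc n → (b ≡ suc a % suc n) ⇔ Follows (suc n) a b
≡suc%⇔follows {n} {a} {b} a<n b<n with m≤n⇒m<n∨m≡n a<n
... | inj₁ 1+a<n = mk⇔ (λ b≡ → inj₁ (trans b≡ no-wrap))
  λ { (inj₁ b≡1+a) → trans b≡1+a (sym no-wrap) ; (inj₂ (_ , 1+a≡n)) → ⊥-elim (<-irrefl 1+a≡n 1+a<n) }
  where
  no-wrap : suc a % suc n ≡ suc a
  no-wrap = m<n⇒m%n≡m 1+a<n
... | inj₂ 1+a≡n = mk⇔ (λ b≡ → inj₂ (trans b≡ wrap , 1+a≡n))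
  λ { (inj₁ b≡1+a) → ⊥-elim (<-irrefl (trans b≡1+a 1+a≡n) b<n) ; (inj₂ (b≡0 , _)) → trans b≡0 (sym wrap) }
  where
  wrap : suc a % suc n ≡ 0
  wrap = trans (cong (_% suc n) 1+a≡n) (n%n≡0 (suc n))

cycle-adj⇔ : ∀ n (i j : Fin n) → CAdj n i j ⇔ CycleAdj n (toℕ i) (toℕ j)
cycle-adj⇔ (suc n) i j = mk⇔ (Sum.map (to i→j) (to j→i)) (Sum.map (from i→j) (from j→i))
  where
  i→j : (toℕ j ≡ suc (toℕ i) % suc n) ⇔ Follows (suc n) (toℕ i) (toℕ j)
  i→j = ≡suc%⇔follows (toℕ<n i) (toℕ<n j)
  j→i : (toℕ i ≡ suc (toℕ j) % suc n) ⇔ Follows (suc n) (toℕ j) (toℕ i)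
  j→i = ≡suc%⇔follows (toℕ<n j) (toℕ<n i)

cycleAdj-irrefl : ∀ {n x} → 3 ≤ n → ¬ CycleAdj n x x
cycleAdj-irrefl {n} {x} 3≤n = Sum.[ not-self , not-self ]
  where
  not-self : ¬ Follows n x x
  not-self (inj₁ x≡1+x)       = 1+n≢n (sym x≡1+x)
  not-self (inj₂ (refl , 1≡n)) = case subst (3 ≤_) (sym 1≡n) 3≤n of λ { (s≤s ()) }

¬cycleAdj-gap : ∀ {n x y} → 2 + x ≤ y → (x ≡ 0 → suc y ≢ n) → ¬ CycleAdj n y x
¬cycleAdj-gap 2+x≤y _ (inj₁ (inj₁ x≡1+y)) = ¬consecutive-gap 2+x≤y (inj₁ x≡1+y)
¬cycleAdj-gap _ no-wrap (inj₁ (inj₂ (x≡0 , 1+y≡n))) = no-wrap x≡0 1+y≡n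
¬cycleAdj-gap 2+x≤y _ (inj₂ (inj₁ y≡1+x)) = ¬consecutive-gap 2+x≤y (inj₂ y≡1+x)
¬cycleAdj-gap 2+x≤y _ (inj₂ (inj₂ (refl , _))) = case 2+x≤y of λ ()

cycle-certificate : ∀ {n} → 3 ≤ n → n ≢ 4 → SegmentCertificate n (CycleAdj n) Kept (_≡ 1)
cycle-certificate {n} 3≤n n≢4 = record
  { dominating = dominating
  ; hub        = 1 , 1<n , refl
  ; locatingᵛ  = locatingᵛ
  ; locatingᵘ  = locatingᵘ
  }
  where
  0<n : 0 < n
  0<n = <-≤-trans z<s 3≤n

  1<n : 1 < n
  1<n = <-≤-trans (s<s z<s) 3≤n

  1≢n : 1 ≢ n
  1≢n 1≡n = <-irrefl 1≡n 1<n

  Witness : (ℕ → Set) → ℕ → ℕ → Set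
  Witness W a b = ∃[ k ] (k < n × W k × Separates (CycleAdj n) a b k)

  separating-predecessor : ∀ {a b} → a < b → b < n → a ≢ 1 → mod3 a ≢ 0 → Witness Kept a b
  separating-predecessor {a} a<b b<n a≢1 a≢0 with predecessor {a} a≢0
  ... | a′ , refl , kept =
    a′ , <-trans (<-trans (n<1+n a′) a<b) b<n , kept ,
    inj₁ (inj₂ (inj₁ refl) , ¬cycleAdj-gap a<b (λ a′≡0 → ⊥-elim (a≢1 (cong suc a′≡0))))

  dominating : ∀ {a} → a < n → ∃[ k ] (k < n × (Kept k ⊎ k ≡ 1) × CycleAdj n a k)
  dominating {a} a<n with mod3 a ≟ 0
  ... | no a≢0 with predecessor {a} a≢0
  ...   | a′ , refl , kept = a′ , <-trans (n<1+n a′) a<n , inj₁ kept , inj₂ (inj₁ refl)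
  dominating {a} a<n | yes a≡0 with m≤n⇒m<n∨m≡n a<n
  ...   | inj₁ 1+a<n = suc a , 1+a<n , inj₁ (kept-suc a a≡0) , inj₁ (inj₁ refl)
  ...   | inj₂ 1+a≡n = 0 , 0<n , inj₁ (λ ()) , inj₁ (inj₂ (refl , 1+a≡n))

  locatingᵛ : ∀ {a b} → a < b → b < n → ¬ Kept a → ¬ Kept b → Witness (λ k → Kept k ⊎ k ≡ 1) a b
  locatingᵛ {a} a<b b<n ¬kept _ with separating-predecessor a<b b<n a≢1 (¬kept⇒≢0 a ¬kept)
    where
    a≢1 : a ≢ 1
    a≢1 refl = ¬kept (λ ())
  ... | k , k<n , t , s = k , k<n , inj₁ t , s

  locatingᵘ : ∀ {a b} → a < b → b < n → a ≢ 1 → b ≢ 1 → Witness Kept a b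
  locatingᵘ {a} a<b b<n a≢1 _ with mod3 a ≟ 0
  ... | no a≢0 = separating-predecessor a<b b<n a≢1 a≢0
  ... | yes a≡0 with m<n⇒n≡1+m∨n≡2+m∨2+m<n a<b
  ...   | inj₁ refl =
          a , <-trans a<b b<n , kept-of a a≡0 (λ ()) , inj₂ (inj₂ (inj₁ refl) , cycleAdj-irrefl 3≤n)
  ...   | inj₂ (inj₂ 2+a<b) =
          suc a , <-trans (<-trans (n<1+n _) 2+a<b) b<n , kept-suc a a≡0 ,
          inj₁ (inj₁ (inj₁ refl) , ¬cycleAdj-gap 2+a<b (λ ()))
  ...   | inj₂ (inj₁ refl) with m≤n⇒m<n∨m≡n b<n
  ...     | inj₁ 3+a<n = 3 + a , 3+a<n , kept-of a a≡0 (λ ()) ,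
                         inj₂ (inj₁ (inj₁ refl) , ¬cycleAdj-gap (s≤s (s≤s (n≤1+n a))) not-C₄ ∘ Sum.swap)
    where
    not-C₄ : a ≡ 0 → 4 + a ≢ n
    not-C₄ refl = n≢4 ∘ sym
  ...     | inj₂ 3+a≡n = 0 , 0<n , (λ ()) , inj₂ (inj₁ (inj₂ (refl , 3+a≡n)) , a≁0)
    where
    a≁0 : ¬ CycleAdj n a 0
    a≁0 (inj₁ (inj₂ (_ , 1+a≡n))) = <-irrefl (trans 1+a≡n (sym 3+a≡n)) (s≤s (s≤s (n≤1+n a)))
    a≁0 (inj₂ (inj₁ a≡1))          = a≢1 a≡1
    a≁0 (inj₂ (inj₂ (_ , 1≡n)))    = 1≢n 1≡n

cycle-γLTD≤ : ∀ {n} → 3 ≤ n → n ≢ 4 → γLTD≤ (M (C n)) (n ∸ n / 3 + 2)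
cycle-γLTD≤ {n} 3≤n n≢4 = subst (λ c → γLTD≤ (M (C n)) (c + 2)) (count-kept-∸ n)
  (segment-γLTD≤ kept? (<-≤-trans (s<s z<s) 3≤n) (cycle-adj⇔ n) (cycle-certificate 3≤n n≢4))

C₄-certificate : SegmentCertificate 4 (CycleAdj 4) (_< 2) (_< 2)
C₄-certificate = record
  { dominating = dominating
  ; hub        = 0 , z<s , z<s
  ; locatingᵛ  = λ a<b b<4 ¬a<2 ¬b<2 →
                   Product.map₂ (Product.map₂ (Product.map₁ inj₁)) (locating a<b b<4 ¬a<2 ¬b<2)
  ; locatingᵘ  = locating
  }
  where
  dominating : ∀ {a} → a < 4 → ∃[ k ] (k < 4 × (k < 2 ⊎ k < 2) × CycleAdj 4 a k)
  dominating {0} _ = 1 , s<s z<s , inj₁ (s<s z<s) , inj₁ (inj₁ refl)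
  dominating {1} _ = 0 , z<s , inj₁ z<s , inj₂ (inj₁ refl)
  dominating {2} _ = 1 , s<s z<s , inj₁ (s<s z<s) , inj₂ (inj₁ refl)
  dominating {3} _ = 0 , z<s , inj₁ z<s , inj₁ (inj₂ (refl , refl))
  dominating {suc (suc (suc (suc _)))} (s≤s (s≤s (s≤s (s≤s ()))))

  locating : ∀ {a b} → a < b → b < 4 → ¬ a < 2 → ¬ b < 2 →
             ∃[ k ] (k < 4 × k < 2 × Separates (CycleAdj 4) a b k)
  locating {0} _ _ ¬a<2 _ = ⊥-elim (¬a<2 z<s)
  locating {1} _ _ ¬a<2 _ = ⊥-elim (¬a<2 (s<s z<s))
  locating {2} {3} _ _ _ _ = 1 , s<s z<s , s<s z<s , inj₁ (inj₂ (inj₁ refl) , 3≁1)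
    where
    3≁1 : ¬ CycleAdj 4 3 1
    3≁1 (inj₁ (inj₁ ()))
    3≁1 (inj₁ (inj₂ (() , _)))
    3≁1 (inj₂ (inj₁ ()))
    3≁1 (inj₂ (inj₂ (() , _)))
  locating {2} {suc (suc (suc (suc _)))} _ (s≤s (s≤s (s≤s (s≤s ())))) _ _
  locating {2} {0} ()
  locating {2} {1} (s≤s ())
  locating {2} {2} (s≤s (s≤s ()))
  locating {suc (suc (suc _))} (s≤s (s≤s (s≤s (s≤s _)))) (s≤s (s≤s (s≤s (s≤s ())))) _ _

C₄-γLTD≤ : γLTD≤ (M (C 4)) 5
C₄-γLTD≤ = mycielski-γLTD≤ {G = C 4} (select (_<? 2) 4) (select (_<? 2) 4)
             (select-unique (_<? 2) 4) (select-unique (_<? 2) 4) (∈-select (_<? 2)) (∈-select (_<? 2))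
             (segment⇒mycielski (cycle-adj⇔ 4) C₄-certificate)

2*[n/6]≤n/3 : ∀ n → 2 * (n / 6) ≤ n / 3
2*[n/6]≤n/3 n = begin
  2 * (n / 6)       ≡⟨ cong (2 *_) (sym (m/n/o≡m/[n*o] n 3 2)) ⟩
  2 * (n / 3 / 2)   ≡⟨ *-comm 2 (n / 3 / 2) ⟩
  n / 3 / 2 * 2     ≤⟨ m/n*n≤m (n / 3) 2 ⟩
  n / 3             ∎
  where open ≤-Reasoning

count-kept-6k : ∀ k x → count kept? (6 * k + x) ≡ 4 * k + count kept? x
count-kept-6k k x = begin
  count kept? (6 * k + x)           ≡⟨ cong (λ t → count kept? (t + x)) (*-assoc 3 2 k) ⟩
  count kept? (3 * (2 * k) + x)     ≡⟨ count-kept (2 * k) x ⟩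
  2 * (2 * k) + count kept? x       ≡⟨ cong (_+ count kept? x) (sym (*-assoc 2 2 k)) ⟩
  4 * k + count kept? x             ∎
  where open ≡-Reasoning

path-bound : ∀ k r → r ≤ 5 → count kept? (6 * k + (5 + r)) + 2 ≡ pathBound (suc k) r
path-bound k r r≤5 = trans (cong (_+ 2) (count-kept-6k k (5 + r))) (closed-form r≤5)
  where
  closed-form : ∀ {r} → r ≤ 5 → 4 * k + count kept? (5 + r) + 2 ≡ pathBound (suc k) r
  closed-form {0} _ = (4 * k + 4 + 2 ≡ 4 * suc k + 2)     ∋ solve (k ∷ [])
  closed-form {1} _ = (4 * k + 4 + 2 ≡ 4 * suc k + 1 + 1) ∋ solve (k ∷ [])
  closed-form {2} _ = (4 * k + 5 + 2 ≡ 4 * suc k + 2 + 1) ∋ solve (k ∷ [])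
  closed-form {3} _ = (4 * k + 6 + 2 ≡ 4 * suc k + 3 + 1) ∋ solve (k ∷ [])
  closed-form {4} _ = (4 * k + 6 + 2 ≡ 4 * suc k + 4)     ∋ solve (k ∷ [])
  closed-form {5} _ = (4 * k + 7 + 2 ≡ 4 * suc k + 5)     ∋ solve (k ∷ [])
  closed-form {suc (suc (suc (suc (suc (suc _)))))} (s≤s (s≤s (s≤s (s≤s (s≤s ())))))

theorem8 : ((k r : ℕ) → 1 ≤ k → r ≤ 5 → γLTD≤ (M (P (6 * k + r))) (pathBound k r))
    × ((n : ℕ) → 3 ≤ n →
    (n % 2 ≡ 1 → γLTD≤ (M (C n)) (n ∸ n / 3 + 2))
    × (n % 2 ≡ 0 → γLTD≤ (M (C n)) (n ∸ 2 * (n / 6) + 2)))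
theorem8 = paths , cycles
  where
  paths : (k r : ℕ) → 1 ≤ k → r ≤ 5 → γLTD≤ (M (P (6 * k + r))) (pathBound k r)
  paths (suc k) r _ r≤5 =
    subst (λ n → γLTD≤ (M (P n)) (pathBound (suc k) r)) vertices
      (subst (γLTD≤ _) (path-bound k r r≤5) (path-γLTD≤ (6 * k + (5 + r)) 2≤6k+5+r))
    where
    vertices : suc (6 * k + (5 + r)) ≡ 6 * suc k + r
    vertices = solve (k ∷ r ∷ [])
    2≤6k+5+r : 2 ≤ 6 * k + (5 + r)
    2≤6k+5+r = ≤-trans (s≤s (s≤s z≤n)) (m≤n+m (5 + r) (6 * k))

  cycles : (n : ℕ) → 3 ≤ n →
           (n % 2 ≡ 1 → γLTD≤ (M (C n)) (n ∸ n / 3 + 2)) × (n % 2 ≡ 0 → γLTD≤ (M (C n)) (n ∸ 2 * (n / 6) + 2))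
  cycles n 3≤n with n ≟ 4
  ... | yes refl = (λ ()) , λ _ → γLTD≤-mono (n≤1+n 5) C₄-γLTD≤
  ... | no n≢4 = (λ _ → cycle-γLTD≤ 3≤n n≢4) ,
                 λ _ → γLTD≤-mono (+-monoˡ-≤ 2 (∸-monoʳ-≤ n (2*[n/6]≤n/3 n))) (cycle-γLTD≤ 3≤n n≢4)
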